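{- Let $x$ be a factor of the Thue--Morse word $\mathbf{t}$ that begins with $1001$ and ends with $1001$, i.e. $x = 1001x'' = x'1001$ for some words $x', x''$. Then the word $x0x0$ is cubefree.
   Context: Let $\mu$ be the morphism on $\{0,1\}^*$ with $\mu(0)=01$, $\mu(1)=10$. The Thue--Morse word $\mathbf{t} = 011010011001011010010110\cdots$ is the infinite word obtained by iterating $\mu$ on $0$. A factor is a contiguous finite subword. A cube is a non-empty word of the form $uuu$; a word is cubefree if none of its factors is a cube. -}

module Defs where

open import Data.Bool using (Bool; true; false)
open import Data.List using (List; []; _∷_; _++_; concatMap)
open import Data.Nat using (ℕ; zero; suc)
open import Data.Product using (∃; ∃-syntax; _×_)
open import Relation.Binary.PropositionalEquality using (_≡_; _≢_)
open import Relation.Nullary using (¬_)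

-- Binary letters: 0 is represented by false, 1 by true.
Word : Set
Word = List Bool

μ-letter : Bool → Word
μ-letter false = false ∷ true ∷ []
μ-letter true  = true ∷ false ∷ []

μ : Word → Word
μ = concatMap μ-letter

-- μⁿ(0); the Thue–Morse word t is the limit, each μⁿ(0) being a prefix of t.
μ^_[0] : ℕ → Word
μ^ zero  [0] = false ∷ []
μ^ suc n [0] = μ (μ^ n [0])

Factor : Word → Word → Set
Factor w v = ∃[ p ] ∃[ s ] v ≡ p ++ w ++ s

-- w is a factor of the Thue–Morse word t (every finite prefix of t is a
-- prefix of some μⁿ(0), so factors of t are exactly factors of some μⁿ(0))
FactorOfTM : Word → Set
FactorOfTM w = ∃[ n ] Factor w (μ^ n [0])

HasCube : Word → Set
HasCube w = ∃[ u ] (u ≢ []) × Factor (u ++ u ++ u) w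

Cubefree : Word → Set
Cubefree w = ¬ HasCube w

w1001 : Word
w1001 = true ∷ false ∷ false ∷ true ∷ []

module Submission where

-- Words are read letter by letter as functions ℕ → Bool.  The Thue–Morse
-- sequence tm satisfies tm(2y) = tm(y) and tm(2y + 1) = not tm(y); from these
-- recurrences alone we prove that tm is overlap-free (it has no window of length
-- 2q + 1 with period q) and that every factor of t is a window of tm.  A cube uuu
-- is a window of length 3|u| and period |u|.  For w = x0x0 we record three facts
-- (CentredSquare): x is a window of tm, w is the square (x0)(x0), and around the
-- middle 0 the word reads 1001 0 1001.  A cube in the second half of w is moved
-- to the first; a cube inside x gives an overlap of tm; a cube reaching the
-- middle 0 either copies the overlap 01010 around it into a copy of x, contains
-- an overlap at the start of the second x, or has period at most 4 and is
-- refuted by a finite check against 100101001.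

open import Defs
open import Data.Bool using (Bool; true; false; not; _xor_)
open import Data.Bool.Properties using (not-injective; not-involutive; not-¬) renaming (_≟_ to _≟-Bool_)
open import Data.List using (List; []; _∷_; _++_; length)
open import Data.List.Properties using (length-++; ++-assoc)
open import Data.Nat
open import Data.Nat.Induction using (<-wellFounded)
open import Data.Nat.Properties
open import Data.Product using (∃; ∃-syntax; _,_; _×_; proj₁; proj₂)
open import Data.Sum using (_⊎_; inj₁; inj₂)
open import Data.Empty using (⊥; ⊥-elim)
open import Induction.WellFounded using (Acc; acc)
open import Relation.Nullary using (¬_; yes; no; Dec)
open import Relation.Nullary.Decidable using (_×-dec_; _→-dec_; ¬?; from-yes)
open import Relation.Binary.PropositionalEquality
open import Data.Nat.Tactic.RingSolver using (solve-∀)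

even-or-odd : ∀ n → (∃[ y ] n ≡ y + y) ⊎ (∃[ y ] n ≡ suc (y + y))
even-or-odd zero = inj₁ (0 , refl)
even-or-odd (suc n) with even-or-odd n
... | inj₁ (y , n≡2y)   = inj₂ (y , cong suc n≡2y)
... | inj₂ (y , n≡2y+1) = inj₁ (suc y , cong suc (trans n≡2y+1 (sym (+-suc y y))))

-- The Thue–Morse sequence t(n) = parity of the binary digit sum of n,
-- computed with an explicit fuel argument f ≥ n.
lastBit : ℕ → Bool
lastBit zero          = false
lastBit (suc zero)    = true
lastBit (suc (suc n)) = lastBit n

tmWithFuel : ℕ → ℕ → Bool
tmWithFuel zero    n = false
tmWithFuel (suc f) n = lastBit n xor tmWithFuel f ⌊ n /2⌋

tm : ℕ → Bool
tm n = tmWithFuel n n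

fuel-irrelevant : ∀ f g n → n ≤ f → n ≤ g → tmWithFuel f n ≡ tmWithFuel g n
fuel-irrelevant f g zero _ _ = trans (at-zero f) (sym (at-zero g))
  where
  at-zero : ∀ f → tmWithFuel f 0 ≡ false
  at-zero zero    = refl
  at-zero (suc f) = at-zero f
fuel-irrelevant (suc f) (suc g) (suc n) (s≤s n≤f) (s≤s n≤g) =
  cong (lastBit (suc n) xor_) (fuel-irrelevant f g ⌊ suc n /2⌋ (≤-trans half≤n n≤f) (≤-trans half≤n n≤g))
  where
  half≤n : ⌊ suc n /2⌋ ≤ n
  half≤n = ≤-pred (⌊n/2⌋<n n)

tm-unfold : ∀ n → tm n ≡ lastBit n xor tm ⌊ n /2⌋
tm-unfold zero    = refl
tm-unfold (suc n) = cong (lastBit (suc n) xor_)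
  (fuel-irrelevant n ⌊ suc n /2⌋ ⌊ suc n /2⌋ (≤-pred (⌊n/2⌋<n n)) ≤-refl)

-- t(2y) = t(y) and t(2y + 1) = not t(y); nothing else about t is used below.
tm-even : ∀ y → tm (y + y) ≡ tm y
tm-even y = begin
  tm (y + y)                            ≡⟨ tm-unfold (y + y) ⟩
  lastBit (y + y) xor tm ⌊ y + y /2⌋    ≡⟨ cong₂ _xor_ (lastBit-even y) (cong tm (sym (n≡⌊n+n/2⌋ y))) ⟩
  tm y                                  ∎
  where
  open ≡-Reasoning
  lastBit-even : ∀ y → lastBit (y + y) ≡ false
  lastBit-even zero    = refl
  lastBit-even (suc y) = trans (cong (λ z → lastBit (suc z)) (+-suc y y)) (lastBit-even y)

tm-odd : ∀ y → tm (suc (y + y)) ≡ not (tm y)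
tm-odd y = begin
  tm (suc (y + y))                                  ≡⟨ tm-unfold (suc (y + y)) ⟩
  lastBit (suc (y + y)) xor tm ⌈ y + y /2⌉          ≡⟨ cong₂ _xor_ (lastBit-odd y) (cong tm (sym (n≡⌈n+n/2⌉ y))) ⟩
  not (tm y)                                        ∎
  where
  open ≡-Reasoning
  lastBit-odd : ∀ y → lastBit (suc (y + y)) ≡ true
  lastBit-odd zero    = refl
  lastBit-odd (suc y) = trans (cong (λ z → lastBit (suc (suc z))) (+-suc y y)) (lastBit-odd y)

tm-pair : ∀ y → tm (suc (y + y)) ≡ not (tm (y + y))
tm-pair y = trans (tm-odd y) (cong not (sym (tm-even y)))

Periodic : (ℕ → Bool) → ℕ → ℕ → ℕ → Set
Periodic f q a len = ∀ k → k + q < len → f (k + a) ≡ f (k + q + a)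

-- An overlap bxbxb of period q = |bx|: a window of length 2q + 1 with period q.
Overlap : (ℕ → Bool) → ℕ → ℕ → Set
Overlap f q a = Periodic f q a (suc (q + q))

overlap-elim : ∀ f {q a k} → Overlap f q a → k ≤ q → f (k + a) ≡ f (k + q + a)
overlap-elim f {q} ov k≤q = ov _ (s≤s (+-monoˡ-≤ q k≤q))

overlap-intro : ∀ f {q a} → (∀ k → k ≤ q → f (k + a) ≡ f (k + q + a)) → Overlap f q a
overlap-intro f {q} per k k+q≤2q = per k (+-cancelʳ-≤ q k q (≤-pred k+q≤2q))

periodic-sub : ∀ f {q a len} d len′ → d + len′ ≤ len → Periodic f q a len → Periodic f q (d + a) len′
periodic-sub f {q} {a} {len} d len′ d+len′≤len per k k+q<len′ = begin
  f (k + (d + a))       ≡⟨ cong f (sym (+-assoc k d a)) ⟩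
  f (k + d + a)         ≡⟨ per (k + d) inside ⟩
  f (k + d + q + a)     ≡⟨ cong f (reorder k d q a) ⟩
  f (k + q + (d + a))   ∎
  where
  open ≡-Reasoning
  reorder : ∀ k d q a → k + d + q + a ≡ k + q + (d + a)
  reorder = solve-∀
  shift-first : ∀ k d q → d + (k + q) ≡ k + d + q
  shift-first = solve-∀
  inside : k + d + q < len
  inside = subst (_< len) (shift-first k d q) (<-≤-trans (+-monoʳ-< d k+q<len′) d+len′≤len)

overlap-transfer : ∀ f g {q a b} → (∀ k → k ≤ q + q → f (k + a) ≡ g (k + b)) →
                   Overlap f q a → Overlap g q b
overlap-transfer f g {q} {a} {b} agree ov = overlap-intro g λ k k≤q → begin
  g (k + b)       ≡⟨ sym (agree k (≤-trans k≤q (m≤m+n q q))) ⟩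
  f (k + a)       ≡⟨ overlap-elim f ov k≤q ⟩
  f (k + q + a)   ≡⟨ agree (k + q) (+-monoˡ-≤ q k≤q) ⟩
  g (k + q + b)   ∎
  where open ≡-Reasoning

-- An overlap of even period 2r in t contracts, via t(2y) = t(y) and
-- t(2y + 1) = not t(y), to an overlap of period r.
halve-overlap : ∀ r a → Overlap tm (r + r) a → ∃[ a′ ] Overlap tm r a′
halve-overlap r a ov with even-or-odd a
... | inj₁ (b , refl) = b , overlap-intro tm λ k k≤r → begin
  tm (k + b)                        ≡⟨ sym (tm-even (k + b)) ⟩
  tm ((k + b) + (k + b))            ≡⟨ cong tm (double-start k b) ⟩
  tm (k + k + (b + b))              ≡⟨ overlap-elim tm ov (+-mono-≤ k≤r k≤r) ⟩
  tm (k + k + (r + r) + (b + b))    ≡⟨ cong tm (double-end k r b) ⟩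
  tm ((k + r + b) + (k + r + b))    ≡⟨ tm-even (k + r + b) ⟩
  tm (k + r + b)                    ∎
  where
  open ≡-Reasoning
  double-start : ∀ k b → (k + b) + (k + b) ≡ k + k + (b + b)
  double-start = solve-∀
  double-end : ∀ k r b → k + k + (r + r) + (b + b) ≡ (k + r + b) + (k + r + b)
  double-end = solve-∀
... | inj₂ (b , refl) = b , overlap-intro tm λ k k≤r → not-injective (begin
  not (tm (k + b))                        ≡⟨ sym (tm-odd (k + b)) ⟩
  tm (suc ((k + b) + (k + b)))            ≡⟨ cong tm (double-start k b) ⟩
  tm (k + k + suc (b + b))                ≡⟨ overlap-elim tm ov (+-mono-≤ k≤r k≤r) ⟩
  tm (k + k + (r + r) + suc (b + b))      ≡⟨ cong tm (double-end k r b) ⟩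
  tm (suc ((k + r + b) + (k + r + b)))    ≡⟨ tm-odd (k + r + b) ⟩
  not (tm (k + r + b))                    ∎)
  where
  open ≡-Reasoning
  double-start : ∀ k b → suc ((k + b) + (k + b)) ≡ k + k + suc (b + b)
  double-start = solve-∀
  double-end : ∀ k r b → k + k + (r + r) + suc (b + b) ≡ suc ((k + r + b) + (k + r + b))
  double-end = solve-∀

-- t has no overlap of odd period 2r + 1: inside such an overlap t would
-- change at every position, so the two ends of the period-(2r + 1) window
-- would differ.
module OddPeriod (r a : ℕ) (ov : Overlap tm (suc (r + r)) a) where

  q : ℕ
  q = suc (r + r)

  FlipAt : ℕ → Set
  FlipAt n = tm (suc n) ≡ not (tm n)

  flip-at-even : ∀ n y → n ≡ y + y → FlipAt n
  flip-at-even n y refl = tm-pair y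

  flip-back : ∀ j → suc j ≤ q → FlipAt (j + q + a) → FlipAt (j + a)
  flip-back j j<q flip = begin
    tm (suc j + a)            ≡⟨ overlap-elim tm ov j<q ⟩
    tm (suc j + q + a)        ≡⟨ flip ⟩
    not (tm (j + q + a))      ≡⟨ cong not (sym (overlap-elim tm ov (<⇒≤ j<q))) ⟩
    not (tm (j + a))          ∎
    where open ≡-Reasoning

  -- either j + a or j + q + a is even, and t changes after an even position
  flips : ∀ j → suc j ≤ q → FlipAt (j + a)
  flips j j<q with even-or-odd (j + a)
  ... | inj₁ (y , j+a≡2y)   = flip-at-even (j + a) y j+a≡2y
  ... | inj₂ (y , j+a≡2y+1) = flip-back j j<q (flip-at-even (j + q + a) (suc (y + r)) shifted-even)
    where
    shifted-even : j + q + a ≡ suc (y + r) + suc (y + r)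
    shifted-even = begin
      j + q + a                  ≡⟨ regroup j a r ⟩
      (j + a) + q                ≡⟨ cong (_+ q) j+a≡2y+1 ⟩
      suc (y + y) + q            ≡⟨ two-odds y r ⟩
      suc (y + r) + suc (y + r)  ∎
      where
      open ≡-Reasoning
      regroup : ∀ j a r → j + suc (r + r) + a ≡ (j + a) + suc (r + r)
      regroup = solve-∀
      two-odds : ∀ y r → suc (y + y) + suc (r + r) ≡ suc (y + r) + suc (y + r)
      two-odds = solve-∀

  -- two changes cancel, so t(2y + a) = t(a) on the first half of the window
  even-steps : ∀ y → y + y ≤ r + r → tm (y + y + a) ≡ tm a
  even-steps zero    _  = refl
  even-steps (suc y) le = begin
    tm (suc y + suc y + a)          ≡⟨ cong (λ z → tm (suc z + a)) (+-suc y y) ⟩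
    tm (suc (suc (y + y)) + a)      ≡⟨ flips (suc (y + y)) (≤-trans le′ (n≤1+n _)) ⟩
    not (tm (suc (y + y) + a))      ≡⟨ cong not (flips (y + y) (≤-trans (n≤1+n _) (≤-trans le′ (n≤1+n _)))) ⟩
    not (not (tm (y + y + a)))      ≡⟨ not-involutive _ ⟩
    tm (y + y + a)                  ≡⟨ even-steps y (≤-trans (n≤1+n _) (≤-trans (n≤1+n _) le′)) ⟩
    tm a                            ∎
    where
    open ≡-Reasoning
    le′ : suc (suc (y + y)) ≤ r + r
    le′ = subst (_≤ r + r) (cong suc (+-suc y y)) le

  contradiction : ⊥
  contradiction = not-¬ refl (begin
    tm a                  ≡⟨ overlap-elim tm ov z≤n ⟩
    tm (q + a)            ≡⟨ flips (r + r) ≤-refl ⟩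
    not (tm (r + r + a))  ≡⟨ cong not (even-steps r ≤-refl) ⟩
    not (tm a)            ∎)
    where open ≡-Reasoning

-- The Thue–Morse sequence is overlap-free: even periods are halved until
-- they become odd, and odd periods are impossible.
tm-overlap-free : ∀ q a → 1 ≤ q → ¬ Overlap tm q a
tm-overlap-free q = go q (<-wellFounded q)
  where
  go : ∀ q → Acc _<_ q → ∀ a → 1 ≤ q → ¬ Overlap tm q a
  go q _ a q≥1 ov with even-or-odd q
  go _ _         a q≥1 ov | inj₂ (r , refl)     = OddPeriod.contradiction r a ov
  go _ _         a q≥1 ov | inj₁ (zero , refl)  = n≮0 q≥1
  go _ (acc rec) a q≥1 ov | inj₁ (suc r , refl) with halve-overlap (suc r) a ov
  ... | a′ , ov′ = go (suc r) (rec (m<m+n (suc r) z<s)) a′ z<s ov′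

-- The k-th letter of a word, read as 0 (false) beyond its end.
letter : Word → ℕ → Bool
letter []      _       = false
letter (b ∷ w) zero    = b
letter (b ∷ w) (suc k) = letter w k

letter-++ˡ : ∀ u v k → k < length u → letter (u ++ v) k ≡ letter u k
letter-++ˡ (b ∷ u) v zero    _         = refl
letter-++ˡ (b ∷ u) v (suc k) (s≤s k<u) = letter-++ˡ u v k k<u

letter-++ʳ : ∀ u v k → letter (u ++ v) (k + length u) ≡ letter v k
letter-++ʳ []      v k = cong (letter v) (+-identityʳ k)
letter-++ʳ (b ∷ u) v k = trans (cong (letter (b ∷ u ++ v)) (+-suc k (length u))) (letter-++ʳ u v k)

μ-cons : ∀ b w → μ (b ∷ w) ≡ b ∷ not b ∷ μ w
μ-cons false w = refl
μ-cons true  w = refl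

length-μ : ∀ w → length (μ w) ≡ length w + length w
length-μ []      = refl
length-μ (b ∷ w) rewrite μ-cons b w | +-suc (length w) (length w) = cong (2 +_) (length-μ w)

letter-μ-even : ∀ w y → letter (μ w) (y + y) ≡ letter w y
letter-μ-even []      y       = refl
letter-μ-even (b ∷ w) zero    rewrite μ-cons b w = refl
letter-μ-even (b ∷ w) (suc y) rewrite μ-cons b w | +-suc y y = letter-μ-even w y

letter-μ-odd : ∀ w y → y < length w → letter (μ w) (suc (y + y)) ≡ not (letter w y)
letter-μ-odd (b ∷ w) zero    _         rewrite μ-cons b w = refl
letter-μ-odd (b ∷ w) (suc y) (s≤s y<w) rewrite μ-cons b w | +-suc y y = letter-μ-odd w y y<w

-- Each μⁿ(0) is a prefix of the Thue–Morse sequence: both satisfy the same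
-- recurrences t(2y) = t(y), t(2y + 1) = not t(y).
tm-prefix : ∀ N k → k < length (μ^ N [0]) → letter (μ^ N [0]) k ≡ tm k
tm-prefix zero    zero    _ = refl
tm-prefix zero    (suc k) (s≤s ())
tm-prefix (suc N) k k<len with even-or-odd k
... | inj₁ (y , refl) = begin
  letter (μ (μ^ N [0])) (y + y)   ≡⟨ letter-μ-even (μ^ N [0]) y ⟩
  letter (μ^ N [0]) y             ≡⟨ tm-prefix N y (halve-< y<len) ⟩
  tm y                            ≡⟨ sym (tm-even y) ⟩
  tm (y + y)                      ∎
  where
  open ≡-Reasoning
  y<len : y + y < length (μ^ N [0]) + length (μ^ N [0])
  y<len = subst (y + y <_) (length-μ (μ^ N [0])) k<len
  halve-< : ∀ {y l} → y + y < l + l → y < l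
  halve-< h = ≰⇒> λ l≤y → <⇒≱ h (+-mono-≤ l≤y l≤y)
... | inj₂ (y , refl) = begin
  letter (μ (μ^ N [0])) (suc (y + y))   ≡⟨ letter-μ-odd (μ^ N [0]) y y<len ⟩
  not (letter (μ^ N [0]) y)             ≡⟨ cong not (tm-prefix N y y<len) ⟩
  not (tm y)                            ≡⟨ sym (tm-odd y) ⟩
  tm (suc (y + y))                      ∎
  where
  open ≡-Reasoning
  y<len : y < length (μ^ N [0])
  y<len = ≰⇒> λ l≤y → <⇒≱ (subst (suc (y + y) <_) (length-μ (μ^ N [0])) k<len)
                            (≤-trans (+-mono-≤ l≤y l≤y) (n≤1+n (y + y)))

inner-position : ∀ (P x S : Word) k → k < length x → k + length P < length (P ++ x ++ S)
inner-position P x S k k<x = begin-strict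
  k + length P                      <⟨ +-monoˡ-< (length P) k<x ⟩
  length x + length P               ≤⟨ +-monoˡ-≤ (length P) (m≤m+n (length x) (length S)) ⟩
  length x + length S + length P    ≡⟨ +-comm (length x + length S) (length P) ⟩
  length P + (length x + length S)  ≡⟨ cong (length P +_) (sym (length-++ x)) ⟩
  length P + length (x ++ S)        ≡⟨ sym (length-++ P) ⟩
  length (P ++ x ++ S)              ∎
  where open ≤-Reasoning

factor-window : ∀ x → FactorOfTM x → ∃[ s ] (∀ k → k < length x → letter x k ≡ tm (k + s))
factor-window x (N , P , S , μᴺ≡PxS) = length P , λ k k<x → begin
  letter x k                          ≡⟨ sym (letter-++ˡ x S k k<x) ⟩
  letter (x ++ S) k                   ≡⟨ sym (letter-++ʳ P (x ++ S) k) ⟩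
  letter (P ++ x ++ S) (k + length P) ≡⟨ cong (λ w → letter w (k + length P)) (sym μᴺ≡PxS) ⟩
  letter (μ^ N [0]) (k + length P)    ≡⟨ tm-prefix N (k + length P) (subst (k + length P <_)
                                           (cong length (sym μᴺ≡PxS)) (inner-position P x S k k<x)) ⟩
  tm (k + length P)                   ∎
  where open ≡-Reasoning

square-prefix : ∀ u v k → k < length u → letter (u ++ u ++ v) k ≡ letter (u ++ u ++ v) (k + length u)
square-prefix u v k k<u = begin
  letter (u ++ u ++ v) k               ≡⟨ letter-++ˡ u (u ++ v) k k<u ⟩
  letter u k                           ≡⟨ sym (letter-++ˡ u v k k<u) ⟩
  letter (u ++ v) k                    ≡⟨ sym (letter-++ʳ u (u ++ v) k) ⟩
  letter (u ++ u ++ v) (k + length u)  ∎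
  where open ≡-Reasoning

cube-prefix : ∀ u v k → k < length u + length u →
              letter (u ++ u ++ u ++ v) k ≡ letter (u ++ u ++ u ++ v) (k + length u)
cube-prefix u v k k<2u with k <? length u
... | yes k<u = square-prefix u (u ++ v) k k<u
... | no  k≮u = subst (λ k → letter (u ++ uuv) k ≡ letter (u ++ uuv) (k + length u)) j+u≡k (begin
  letter (u ++ uuv) (j + length u)               ≡⟨ letter-++ʳ u uuv j ⟩
  letter uuv j                                   ≡⟨ square-prefix u v j j<u ⟩
  letter uuv (j + length u)                      ≡⟨ sym (letter-++ʳ u uuv (j + length u)) ⟩
  letter (u ++ uuv) (j + length u + length u)    ∎)
  where
  open ≡-Reasoning
  uuv = u ++ u ++ v
  j = k ∸ length u
  j+u≡k : j + length u ≡ k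
  j+u≡k = m∸n+n≡m (≮⇒≥ k≮u)
  j<u : j < length u
  j<u = +-cancelʳ-< (length u) j (length u) (subst (_< length u + length u) (sym j+u≡k) k<2u)

cube-window : ∀ w → HasCube w →
              ∃[ i ] ∃[ p ] (1 ≤ p × i + (p + p + p) ≤ length w × Periodic (letter w) p i (p + p + p))
cube-window w (u , u≢[] , A , B , w≡AuuuB) = length A , length u , nonempty u u≢[] , fits , periodic
  where
  p = length u
  w≡AuuuB′ : w ≡ A ++ (u ++ u ++ u ++ B)
  w≡AuuuB′ = trans w≡AuuuB (cong (A ++_) (trans (++-assoc u (u ++ u) B) (cong (u ++_) (++-assoc u u B))))
  nonempty : ∀ (v : Word) → v ≢ [] → 1 ≤ length v
  nonempty []      v≢[] = ⊥-elim (v≢[] refl)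
  nonempty (_ ∷ _) _    = s≤s z≤n
  fits : length A + (p + p + p) ≤ length w
  fits = begin
    length A + (p + p + p)                   ≤⟨ +-monoʳ-≤ (length A) (m≤m+n (p + p + p) (length B)) ⟩
    length A + (p + p + p + length B)        ≡⟨ cong (length A +_) (length-uuuB u B) ⟩
    length A + length (u ++ u ++ u ++ B)     ≡⟨ sym (length-++ A) ⟩
    length (A ++ (u ++ u ++ u ++ B))         ≡⟨ cong length (sym w≡AuuuB′) ⟩
    length w                                 ∎
    where
    open ≤-Reasoning
    length-uuuB : ∀ (u B : Word) → length u + length u + length u + length B ≡ length (u ++ u ++ u ++ B)
    length-uuuB u B = sym (begin-equality
      length (u ++ u ++ u ++ B)                        ≡⟨ length-++ u ⟩
      length u + length (u ++ u ++ B)                  ≡⟨ cong (length u +_) (length-++ u) ⟩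
      length u + (length u + length (u ++ B))          ≡⟨ cong (λ l → length u + (length u + l)) (length-++ u) ⟩
      length u + (length u + (length u + length B))    ≡⟨ regroup (length u) (length B) ⟩
      length u + length u + length u + length B        ∎)
      where
      regroup : ∀ p b → p + (p + (p + b)) ≡ p + p + p + b
      regroup = solve-∀
  periodic : Periodic (letter w) p (length A) (p + p + p)
  periodic k k+p<3p = begin
    letter w (k + length A)                      ≡⟨ cong (λ v → letter v (k + length A)) w≡AuuuB′ ⟩
    letter (A ++ (u ++ u ++ u ++ B)) (k + length A)      ≡⟨ letter-++ʳ A _ k ⟩
    letter (u ++ u ++ u ++ B) k                  ≡⟨ cube-prefix u B k (+-cancelʳ-< p k (p + p) k+p<3p) ⟩
    letter (u ++ u ++ u ++ B) (k + p)            ≡⟨ sym (letter-++ʳ A _ (k + p)) ⟩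
    letter (A ++ (u ++ u ++ u ++ B)) (k + p + length A)  ≡⟨ cong (λ v → letter v (k + p + length A)) (sym w≡AuuuB′) ⟩
    letter w (k + p + length A)                  ∎
    where open ≡-Reasoning

letter-square : ∀ v k → k < length v → letter (v ++ v) (k + length v) ≡ letter (v ++ v) k
letter-square v k k<v = trans (letter-++ʳ v v k) (sym (letter-++ˡ v v k k<v))

-- The word 1001 0 1001 around the middle letter of x0x0.
centreWord : Word
centreWord = w1001 ++ false ∷ w1001

x0x0 : Word → Word
x0x0 x = x ++ false ∷ x ++ false ∷ []

-- Positional description of x0x0 for a Thue–Morse factor x = x′1001 = 1001x″
-- with |x′| = m, so that |x| = 4 + m and |x0| = 5 + m.
record CentredSquare (W : ℕ → Bool) (m : ℕ) : Set where
  field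
    offset   : ℕ
    in-tm    : ∀ k → k < 4 + m → W k ≡ tm (k + offset)
    periodic : ∀ k → k < 5 + m → W (k + (5 + m)) ≡ W k
    centre   : ∀ j → j < 9 → W (j + m) ≡ letter centreWord j

length-x : ∀ x x′ → x ≡ x′ ++ w1001 → length x ≡ 4 + length x′
length-x x x′ x≡x′1001 = trans (cong length x≡x′1001) (trans (length-++ x′) (+-comm (length x′) 4))

length-x0x0 : ∀ x x′ → x ≡ x′ ++ w1001 → length (x0x0 x) ≡ (5 + length x′) + (5 + length x′)
length-x0x0 x x′ x≡x′1001 = begin
  length (x0x0 x)                       ≡⟨ length-++ x ⟩
  length x + suc (length (x ++ false ∷ []))  ≡⟨ cong (λ l → length x + suc l) (length-++ x) ⟩
  length x + suc (length x + 1)         ≡⟨ cong (λ l → l + suc (l + 1)) (length-x x x′ x≡x′1001) ⟩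
  4 + m + suc (4 + m + 1)               ≡⟨ regroup m ⟩
  (5 + m) + (5 + m)                     ∎
  where
  open ≡-Reasoning
  m = length x′
  regroup : ∀ m → 4 + m + suc (4 + m + 1) ≡ (5 + m) + (5 + m)
  regroup = solve-∀

x0x0-centred : ∀ x x′ x″ → FactorOfTM x → x ≡ w1001 ++ x″ → x ≡ x′ ++ w1001 →
               CentredSquare (letter (x0x0 x)) (length x′)
x0x0-centred x x′ x″ factor x≡1001x″ x≡x′1001 = record
  { offset   = s
  ; in-tm    = λ k k<n → let k<x = subst (k <_) (sym |x|≡n) k<n in
                 trans (letter-++ˡ x _ k k<x) (x≡t k k<x)
  ; periodic = λ k k<N → begin
      letter (x0x0 x) (k + (5 + m))          ≡⟨ cong₂ letter (sym square) (cong (k +_) (sym |x0|≡N)) ⟩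
      letter (x0 ++ x0) (k + length x0)      ≡⟨ letter-square x0 k (subst (k <_) (sym |x0|≡N) k<N) ⟩
      letter (x0 ++ x0) k                    ≡⟨ cong (λ w → letter w k) square ⟩
      letter (x0x0 x) k                      ∎
  ; centre   = λ j j<9 → begin
      letter (x0x0 x) (j + m)                ≡⟨ cong (λ w → letter w (j + m)) split-at-centre ⟩
      letter (x′ ++ centreWord ++ rest) (j + m)  ≡⟨ letter-++ʳ x′ _ j ⟩
      letter (centreWord ++ rest) j          ≡⟨ letter-++ˡ centreWord rest j j<9 ⟩
      letter centreWord j                    ∎
  }
  where
  open ≡-Reasoning
  m = length x′
  s = proj₁ (factor-window x factor)
  x≡t = proj₂ (factor-window x factor)
  |x|≡n : length x ≡ 4 + m
  |x|≡n = length-x x x′ x≡x′1001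
  x0 = x ++ false ∷ []
  |x0|≡N : length x0 ≡ 5 + m
  |x0|≡N = trans (length-++ x) (trans (cong (_+ 1) |x|≡n) (+-comm (4 + m) 1))
  square : x0 ++ x0 ≡ x0x0 x
  square = ++-assoc x (false ∷ []) x0
  rest = x″ ++ false ∷ []
  -- replace the first x by x′1001 and the second by 1001x″
  split-at-centre : x0x0 x ≡ x′ ++ centreWord ++ rest
  split-at-centre = trans (cong₂ (λ a b → a ++ false ∷ b ++ false ∷ []) x≡x′1001 x≡1001x″)
                          (++-assoc x′ w1001 (false ∷ (w1001 ++ x″) ++ false ∷ []))

-- A cube of period p starting L letters before the middle 0 of x0x0 compares
-- position j of the centre window 100101001 (which starts 4 letters before the
-- middle 0) with position j + p.  A clash is such a comparison that fails.
Clash : ℕ → ℕ → Set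
Clash p L = ∃ λ k → k < p + p × ∃ λ j → j < 9 ×
              (k + 4 ≡ L + j × j + p < 9 × letter centreWord j ≢ letter centreWord (j + p))

clash? : ∀ p L → Dec (Clash p L)
clash? p L = anyUpTo? (λ k → anyUpTo? (λ j →
  (k + 4 ≟ L + j) ×-dec (j + p <? 9) ×-dec ¬? (letter centreWord j ≟-Bool letter centreWord (j + p))) 9) (p + p)

-- The cubes of period at most 4 left over by the case analysis below.
SmallCube : ℕ → ℕ → Set
SmallCube p L = 1 ≤ p → p ≤ 4 → L ≤ p + p → p ≤ L + 2 → Clash p L

small-cubes-clash : ∀ {p} → p < 5 → ∀ {L} → L < 9 → SmallCube p L
small-cubes-clash = from-yes (allUpTo? (λ p → allUpTo? (λ L →
  (1 ≤? p) →-dec (p ≤? 4) →-dec (L ≤? p + p) →-dec (p ≤? L + 2) →-dec clash? p L) 9) 5)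

module Bounds where
  open ≤-Reasoning

  window-inside : ∀ {k q a n} → k ≤ q + q → a + (q + q) < n → k + a < n
  window-inside {k} {q} {a} {n} k≤2q a+2q<n = begin-strict
    k + a        ≤⟨ +-monoˡ-≤ a k≤2q ⟩
    q + q + a    ≡⟨ +-comm (q + q) a ⟩
    a + (q + q)  <⟨ a+2q<n ⟩
    n            ∎

  overlap-in-cube : ∀ {p} → 1 ≤ p → suc (p + p) ≤ p + p + p
  overlap-in-cube {p} p≥1 = subst (_≤ p + p + p) (+-comm (p + p) 1) (+-monoʳ-≤ (p + p) p≥1)

  cube-start : ∀ {i p N} → 1 ≤ p → i + (p + p + p) ≤ N → i < N
  cube-start {i} {p} {N} p≥1 fits = begin-strict
    i                  <⟨ m<m+n i (≤-trans p≥1 (m≤n+m p (p + p))) ⟩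
    i + (p + p + p)    ≤⟨ fits ⟩
    N                  ∎

  reaches-centre : ∀ {i L p n} → i + L ≡ n → ¬ (i + (p + p) < n) → L ≤ p + p
  reaches-centre {i} {L} {p} i+L≡n ¬inside = +-cancelˡ-≤ i L (p + p) (subst (_≤ i + (p + p)) (sym i+L≡n) (≮⇒≥ ¬inside))

  shifted-cube-fits : ∀ {i p N} → N + i + (p + p + p) ≤ N + N → i + (p + p + p) ≤ N
  shifted-cube-fits {i} {p} {N} fits = +-cancelˡ-≤ N (i + (p + p + p)) N (subst (_≤ N + N) (+-assoc N i _) fits)

  inside-cube : ∀ {k p i N} → k + p < p + p + p → i + (p + p + p) ≤ N → k + p + i < N
  inside-cube {k} {p} {i} {N} k+p<3p fits = begin-strict
    k + p + i          <⟨ +-monoˡ-< i k+p<3p ⟩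
    p + p + p + i      ≡⟨ +-comm (p + p + p) i ⟩
    i + (p + p + p)    ≤⟨ fits ⟩
    N                  ∎

  -- case (a): a cube starting at least p + 2 letters before the middle 0
  before-centre-cube : ∀ {k c p} → k ≤ 4 → p + 2 + c ≤ p + p → 3 ≤ p → k + c + p < p + p + p
  before-centre-cube {k} {c} {p} k≤4 L≤2p p≥3 = begin-strict
    k + c + p           ≤⟨ +-monoˡ-≤ p (+-monoˡ-≤ c k≤4) ⟩
    4 + c + p           <⟨ n<1+n _ ⟩
    3 + (2 + c) + p     ≤⟨ +-monoˡ-≤ p (+-monoʳ-≤ 3 c+2≤p) ⟩
    3 + p + p           ≤⟨ +-monoˡ-≤ p (+-monoˡ-≤ p p≥3) ⟩
    p + p + p           ∎
    where
    c+2≤p : 2 + c ≤ p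
    c+2≤p = +-cancelˡ-≤ p (2 + c) p (subst (_≤ p + p) (+-assoc p 2 c) L≤2p)

  before-centre-start : ∀ {i p c m} → i + (p + 2 + c) ≡ 4 + m → 2 + m ≡ c + p + i
  before-centre-start {i} {p} {c} {m} eq = +-cancelˡ-≡ 2 (2 + m) (c + p + i) (trans (sym eq) (regroup i p c))
    where
    regroup : ∀ i p c → i + (p + 2 + c) ≡ 2 + (c + p + i)
    regroup = solve-∀

  before-centre-inside : ∀ {i p c m} → i + (p + 2 + c) ≡ 4 + m → 3 ≤ p → c + i + 4 < 4 + m
  before-centre-inside {i} {p} {c} {m} eq p≥3 = begin-strict
    c + i + 4             <⟨ n<1+n _ ⟩
    suc (c + i + 4)       ≡⟨ regroup c i ⟩
    i + (3 + 2 + c)       ≤⟨ +-monoʳ-≤ i (+-monoˡ-≤ c (+-monoˡ-≤ 2 p≥3)) ⟩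
    i + (p + 2 + c)       ≡⟨ eq ⟩
    4 + m                 ∎
    where
    regroup : ∀ c i → suc (c + i + 4) ≡ i + (3 + 2 + c)
    regroup = solve-∀

  -- case (b): a cube starting between 2 and p + 1 letters before the middle 0
  after-centre-cube : ∀ {k c e} → k ≤ 4 → c ≤ e + 2 → 2 ≤ e →
                      k + c + (3 + e) < (3 + e) + (3 + e) + (3 + e)
  after-centre-cube {k} {c} {e} k≤4 c≤e+2 e≥2 = begin-strict
    k + c + (3 + e)              ≤⟨ +-monoˡ-≤ (3 + e) (+-mono-≤ k≤4 c≤e+2) ⟩
    4 + (e + 2) + (3 + e)        <⟨ n<1+n _ ⟩
    suc (4 + (e + 2) + (3 + e))  ≡⟨ regroup₁ e ⟩
    (9 + e + e) + 1              ≤⟨ +-monoʳ-≤ (9 + e + e) (≤-trans (s≤s z≤n) e≥2) ⟩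
    (9 + e + e) + e              ≡⟨ regroup₂ e ⟩
    (3 + e) + (3 + e) + (3 + e)  ∎
    where
    regroup₁ : ∀ e → suc (4 + (e + 2) + (3 + e)) ≡ 9 + e + e + 1
    regroup₁ = solve-∀
    regroup₂ : ∀ e → 9 + e + e + e ≡ (3 + e) + (3 + e) + (3 + e)
    regroup₂ = solve-∀

  after-centre-start : ∀ {i c m} → i + (2 + c) ≡ 4 + m → 2 + m ≡ c + i
  after-centre-start {i} {c} {m} eq = +-cancelˡ-≡ 2 (2 + m) (c + i) (trans (sym eq) (regroup i c))
    where
    regroup : ∀ i c → i + (2 + c) ≡ 2 + (c + i)
    regroup = solve-∀

  after-centre-inside : ∀ {i c e m} → i + (2 + c) ≡ 4 + m → c ≤ e + 2 → 2 ≤ e →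
                        i + ((3 + e) + (3 + e) + (3 + e)) ≤ (5 + m) + (5 + m) → e + 4 < 4 + m
  after-centre-inside {i} {c} {e} {m} eq c≤e+2 e≥2 fits =
    +-cancelʳ-≤ (e + e + 4) (suc (e + 4)) (4 + m) (begin
      suc (e + 4) + (e + e + 4)   ≡⟨ regroup₃ e ⟩
      9 + (e + e + e)             ≤⟨ three-e ⟩
      10 + m + e                  ≡⟨ regroup₄ m e ⟩
      (8 + m + e) + 2             ≤⟨ +-monoʳ-≤ (8 + m + e) e≥2 ⟩
      (8 + m + e) + e             ≡⟨ regroup₅ m e ⟩
      (4 + m) + (e + e + 4)       ∎)
    where
    regroup₁ : ∀ i c e → (i + (2 + c)) + (9 + (e + e + e)) ≡ i + ((3 + e) + (3 + e) + (3 + e)) + (2 + c)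
    regroup₁ = solve-∀
    regroup₂ : ∀ m e → (5 + m) + (5 + m) + (2 + (e + 2)) ≡ (4 + m) + (10 + m + e)
    regroup₂ = solve-∀
    regroup₃ : ∀ e → suc (e + 4) + (e + e + 4) ≡ 9 + (e + e + e)
    regroup₃ = solve-∀
    regroup₄ : ∀ m e → 10 + m + e ≡ (8 + m + e) + 2
    regroup₄ = solve-∀
    regroup₅ : ∀ m e → (8 + m + e) + e ≡ (4 + m) + (e + e + 4)
    regroup₅ = solve-∀
    -- the cube has length 9 + 3e and fits in the 10 + 2m letters of x0x0
    three-e : 9 + (e + e + e) ≤ 10 + m + e
    three-e = +-cancelˡ-≤ (4 + m) (9 + (e + e + e)) (10 + m + e) (begin
      (4 + m) + (9 + (e + e + e))                 ≡⟨ cong (_+ (9 + (e + e + e))) eq ⟨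
      (i + (2 + c)) + (9 + (e + e + e))           ≡⟨ regroup₁ i c e ⟩
      i + ((3 + e) + (3 + e) + (3 + e)) + (2 + c) ≤⟨ +-monoˡ-≤ (2 + c) fits ⟩
      (5 + m) + (5 + m) + (2 + c)                 ≤⟨ +-monoʳ-≤ ((5 + m) + (5 + m)) (+-monoʳ-≤ 2 c≤e+2) ⟩
      (5 + m) + (5 + m) + (2 + (e + 2))           ≡⟨ regroup₂ m e ⟩
      (4 + m) + (10 + m + e)                      ∎)

  -- case (c): a cube starting at most one letter before the middle 0
  at-centre-window : ∀ {L p} → L + 2 < p → suc L + suc (p + p) ≤ p + p + p
  at-centre-window {L} {p} L+2<p = begin
    suc L + suc (p + p)  ≡⟨ regroup L p ⟩
    (L + 2) + (p + p)    ≤⟨ +-monoˡ-≤ (p + p) (<⇒≤ L+2<p) ⟩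
    p + (p + p)          ≡⟨ +-assoc p p p ⟨
    p + p + p            ∎
    where
    regroup : ∀ L p → suc L + suc (p + p) ≡ (L + 2) + (p + p)
    regroup = solve-∀

  at-centre-inside : ∀ {i L p m} → i + L ≡ 4 + m → L + 2 < p →
                     i + (p + p + p) ≤ (5 + m) + (5 + m) → p + p < 4 + m
  at-centre-inside {i} {L} {p} {m} i+L≡n L+2<p fits = +-cancelʳ-≤ (m + L + 6) (suc (p + p)) (4 + m) (begin
    suc (p + p) + (m + L + 6)        ≡⟨ regroup₁ p m L ⟩
    (4 + m) + (suc (L + 2) + (p + p)) ≤⟨ +-monoʳ-≤ (4 + m) (+-monoˡ-≤ (p + p) L+2<p) ⟩
    (4 + m) + (p + (p + p))          ≡⟨ cong (_+ (p + (p + p))) i+L≡n ⟨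
    (i + L) + (p + (p + p))          ≡⟨ regroup₂ i L p ⟩
    i + (p + p + p) + L              ≤⟨ +-monoˡ-≤ L fits ⟩
    (5 + m) + (5 + m) + L            ≡⟨ regroup₃ m L ⟩
    (4 + m) + (m + L + 6)            ∎)
    where
    regroup₁ : ∀ p m L → suc (p + p) + (m + L + 6) ≡ (4 + m) + (suc (L + 2) + (p + p))
    regroup₁ = solve-∀
    regroup₂ : ∀ i L p → (i + L) + (p + (p + p)) ≡ i + (p + p + p) + L
    regroup₂ = solve-∀
    regroup₃ : ∀ m L → (5 + m) + (5 + m) + L ≡ (4 + m) + (m + L + 6)
    regroup₃ = solve-∀

  -- a clash compares positions j + m and j + p + m of x0x0
  clash-position : ∀ {k i j L m} → k + 4 ≡ L + j → i + L ≡ 4 + m → k + i ≡ j + m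
  clash-position {k} {i} {j} {L} {m} k+4≡L+j i+L≡n = +-cancelˡ-≡ 4 (k + i) (j + m) (begin-equality
    4 + (k + i)      ≡⟨ +-assoc 4 k i ⟨
    4 + k + i        ≡⟨ cong (_+ i) (+-comm 4 k) ⟩
    k + 4 + i        ≡⟨ cong (_+ i) k+4≡L+j ⟩
    L + j + i        ≡⟨ regroup₁ L j i ⟩
    j + (i + L)      ≡⟨ cong (j +_) i+L≡n ⟩
    j + (4 + m)      ≡⟨ regroup₂ j m ⟩
    4 + (j + m)      ∎)
    where
    regroup₁ : ∀ L j i → L + j + i ≡ j + (i + L)
    regroup₁ = solve-∀
    regroup₂ : ∀ j m → j + (4 + m) ≡ 4 + (j + m)
    regroup₂ = solve-∀

module NoCube {W : ℕ → Bool} {m : ℕ} (S : CentredSquare W m) where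
  open CentredSquare S
  open Bounds

  -- the middle 0 sits at position n = |x|; the square has period N = |x0|
  n N : ℕ
  n = 4 + m
  N = 5 + m

  Cube : ℕ → ℕ → Set
  Cube i p = Periodic W p i (p + p + p)

  -- overlaps inside either copy of x would be overlaps of t
  no-overlap-in-x : ∀ q a → 1 ≤ q → a + (q + q) < n → ¬ Overlap W q a
  no-overlap-in-x q a q≥1 a+2q<n ov = tm-overlap-free q (a + offset) q≥1 (overlap-transfer W tm agree ov)
    where
    agree : ∀ k → k ≤ q + q → W (k + a) ≡ tm (k + (a + offset))
    agree k k≤2q = trans (in-tm (k + a) (window-inside {q = q} k≤2q a+2q<n)) (cong tm (+-assoc k a offset))

  no-overlap-in-second-x : ∀ q a → 1 ≤ q → a + (q + q) < n → ¬ Overlap W q (a + N)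
  no-overlap-in-second-x q a q≥1 a+2q<n ov = no-overlap-in-x q a q≥1 a+2q<n (overlap-transfer W W agree ov)
    where
    agree : ∀ k → k ≤ q + q → W (k + (a + N)) ≡ W (k + a)
    agree k k≤2q = trans (cong W (sym (+-assoc k a N))) (periodic (k + a) (m≤n⇒m≤1+n (window-inside {q = q} k≤2q a+2q<n)))

  -- the letters 01010 around the middle 0 form an overlap of period 2
  centre-overlap : Overlap W 2 (2 + m)
  centre-overlap = overlap-transfer (letter centreWord) W agree 01010-overlap
    where
    01010-overlap : Overlap (letter centreWord) 2 2
    01010-overlap = overlap-intro (letter centreWord) λ
      { 0 _ → refl ; 1 _ → refl ; 2 _ → refl ; (suc (suc (suc _))) (s≤s (s≤s ())) }
    agree : ∀ k → k ≤ 2 + 2 → letter centreWord (k + 2) ≡ W (k + (2 + m))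
    agree k k≤4 = trans (sym (centre (k + 2) (s≤s (≤-trans (+-monoˡ-≤ 2 k≤4) (m≤n+m 6 2))))) (cong W (+-assoc k 2 m))

  clash-refutes : ∀ i p L → i + L ≡ n → Clash p L → ¬ Cube i p
  clash-refutes i p L i+L≡n (k , k<2p , j , j<9 , k+4≡L+j , j+p<9 , differ) cube = differ (begin
    letter centreWord j        ≡⟨ sym (centre j j<9) ⟩
    W (j + m)                  ≡⟨ cong W (sym same) ⟩
    W (k + i)                  ≡⟨ cube k (+-monoˡ-< p k<2p) ⟩
    W (k + p + i)              ≡⟨ cong W shifted ⟩
    W (j + p + m)              ≡⟨ centre (j + p) j+p<9 ⟩
    letter centreWord (j + p)  ∎)
    where
    open ≡-Reasoning
    same : k + i ≡ j + m
    same = clash-position k+4≡L+j i+L≡n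
    shifted : k + p + i ≡ j + p + m
    shifted = begin
      k + p + i    ≡⟨ +-assoc k p i ⟩
      k + (p + i)  ≡⟨ cong (k +_) (+-comm p i) ⟩
      k + (i + p)  ≡⟨ +-assoc k i p ⟨
      k + i + p    ≡⟨ cong (_+ p) same ⟩
      j + m + p    ≡⟨ +-assoc j m p ⟩
      j + (m + p)  ≡⟨ cong (j +_) (+-comm m p) ⟩
      j + (p + m)  ≡⟨ +-assoc j p m ⟨
      j + p + m    ∎

  -- (a) a cube starting at least p + 2 letters before the middle 0 copies the
  -- overlap 01010 p letters to the left, into the first x
  before-centre : ∀ i p c → i + (p + 2 + c) ≡ n → p + 2 + c ≤ p + p → 3 ≤ p → ¬ Cube i p
  before-centre i p c eq L≤2p p≥3 cube =
    no-overlap-in-x 2 (c + i) z<s (before-centre-inside {i} {p} {c} eq p≥3) (overlap-transfer W W agree centre-overlap)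
    where
    open ≡-Reasoning
    agree : ∀ k → k ≤ 4 → W (k + (2 + m)) ≡ W (k + (c + i))
    agree k k≤4 = begin
      W (k + (2 + m))      ≡⟨ cong (λ z → W (k + z)) (before-centre-start {i} {p} {c} eq) ⟩
      W (k + (c + p + i))  ≡⟨ cong W (regroup k c p i) ⟩
      W (k + c + p + i)    ≡⟨ cube (k + c) (before-centre-cube k≤4 L≤2p p≥3) ⟨
      W (k + c + i)        ≡⟨ cong W (+-assoc k c i) ⟩
      W (k + (c + i))      ∎
      where
      regroup : ∀ k c p i → k + (c + p + i) ≡ k + c + p + i
      regroup = solve-∀

  -- (b) a cube starting between 2 and p + 1 letters before the middle 0
  -- copies the overlap 01010 p letters to the right, into the second x
  after-centre : ∀ i p c → i + (2 + c) ≡ n → 2 + c < p + 2 → 5 ≤ p →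
                 i + (p + p + p) ≤ N + N → ¬ Cube i p
  after-centre i p c eq L<p+2 p≥5 fits cube with m≤n⇒∃[o]m+o≡n (≤-trans (s≤s (s≤s (s≤s z≤n))) p≥5)
  ... | e , refl = no-overlap-in-second-x 2 e z<s (after-centre-inside eq c≤e+2 e≥2 fits)
                     (overlap-transfer W W agree centre-overlap)
    where
    open ≡-Reasoning
    c≤e+2 : c ≤ e + 2
    c≤e+2 = ≤-pred (≤-pred (≤-pred L<p+2))
    e≥2 : 2 ≤ e
    e≥2 = ≤-pred (≤-pred (≤-pred p≥5))
    agree : ∀ k → k ≤ 4 → W (k + (2 + m)) ≡ W (k + (e + N))
    agree k k≤4 = begin
      W (k + (2 + m))          ≡⟨ cong (λ z → W (k + z)) (after-centre-start eq) ⟩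
      W (k + (c + i))          ≡⟨ cong W (+-assoc k c i) ⟨
      W (k + c + i)            ≡⟨ cube (k + c) (after-centre-cube k≤4 c≤e+2 e≥2) ⟩
      W (k + c + (3 + e) + i)  ≡⟨ cong W (regroup k c e i) ⟩
      W (k + (e + (3 + (c + i)))) ≡⟨ cong (λ z → W (k + (e + (3 + z)))) (after-centre-start eq) ⟨
      W (k + (e + N))          ∎
      where
      regroup : ∀ k c e i → k + c + (3 + e) + i ≡ k + (e + (3 + (c + i)))
      regroup = solve-∀

  -- (c) a cube starting at most one letter before the middle 0 contains an
  -- overlap at the start of the second x
  at-centre : ∀ i p L → i + L ≡ n → L + 2 < p → i + (p + p + p) ≤ N + N → ¬ Cube i p
  at-centre i p L i+L≡n L+2<p fits cube =
    no-overlap-in-second-x p 0 (≤-trans (s≤s z≤n) L+2<p) (at-centre-inside i+L≡n L+2<p fits)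
      (subst (Overlap W p) N≡L+1+i (periodic-sub W (suc L) (suc (p + p)) (at-centre-window L+2<p) cube))
    where
    N≡L+1+i : suc L + i ≡ N
    N≡L+1+i = cong suc (trans (+-comm L i) i+L≡n)

  -- a cube that starts L ≤ 2p letters before the middle 0 falls under (a), (b),
  -- (c) or one of the small cases
  around-centre : ∀ i p L → i + L ≡ n → 1 ≤ p → L ≤ p + p → i + (p + p + p) ≤ N + N → ¬ Cube i p
  around-centre i p L i+L≡n p≥1 L≤2p fits with L ≤? 1
  ... | yes L≤1 with p ≤? L + 2
  ...   | yes p≤L+2 = clash-refutes i p L i+L≡n
                        (small-cubes-clash (s≤s p≤4) (s≤s (≤-trans L≤1 (s≤s z≤n))) p≥1 p≤4 L≤2p p≤L+2)
    where
    p≤4 : p ≤ 4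
    p≤4 = ≤-trans p≤L+2 (≤-trans (+-monoˡ-≤ 2 L≤1) (n≤1+n 3))
  ...   | no  p≰L+2 = at-centre i p L i+L≡n (≰⇒> p≰L+2) fits
  around-centre i p L i+L≡n p≥1 L≤2p fits | no L≰1 with p ≤? 4
  ... | yes p≤4 = clash-refutes i p L i+L≡n
                    (small-cubes-clash (s≤s p≤4) (s≤s (≤-trans L≤2p (+-mono-≤ p≤4 p≤4))) p≥1 p≤4 L≤2p
                      (≤-trans p≤4 (+-monoˡ-≤ 2 (≰⇒> L≰1))))
  ... | no  p≰4 with p + 2 ≤? L
  ...   | yes p+2≤L with m≤n⇒∃[o]m+o≡n p+2≤L
  ...     | c , refl = before-centre i p c i+L≡n L≤2p (≤-trans (s≤s (s≤s (s≤s z≤n))) (≰⇒> p≰4))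
  around-centre i p L i+L≡n p≥1 L≤2p fits | no L≰1 | no p≰4 | no p+2≰L
    with m≤n⇒∃[o]m+o≡n (≰⇒> L≰1)
  ... | c , refl = after-centre i p c i+L≡n (≰⇒> p+2≰L) (≰⇒> p≰4) fits

  -- a cube starting in the first x0 either lies inside x or reaches the middle 0
  from-first-half : ∀ i p → 1 ≤ p → i ≤ n → i + (p + p + p) ≤ N + N → ¬ Cube i p
  from-first-half i p p≥1 i≤n fits cube with i + (p + p) <? n
  ... | yes inside = no-overlap-in-x p i p≥1 inside (periodic-sub W 0 (suc (p + p)) (overlap-in-cube {p} p≥1) cube)
  ... | no  reaches with m≤n⇒∃[o]m+o≡n i≤n
  ...   | L , i+L≡n = around-centre i p L i+L≡n p≥1 (reaches-centre {p = p} i+L≡n reaches) fits cube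

  -- a cube in the second x0 is a copy of one in the first
  shift-back : ∀ i p → i + (p + p + p) ≤ N → Cube (N + i) p → Cube i p
  shift-back i p fits cube k k+p<3p = begin
    W (k + i)              ≡⟨ periodic (k + i) (≤-<-trans (+-monoˡ-≤ i (m≤m+n k p)) inside) ⟨
    W (k + i + N)          ≡⟨ cong W (regroup k i N) ⟩
    W (k + (N + i))        ≡⟨ cube k k+p<3p ⟩
    W (k + p + (N + i))    ≡⟨ cong W (regroup (k + p) i N) ⟨
    W (k + p + i + N)      ≡⟨ periodic (k + p + i) inside ⟩
    W (k + p + i)          ∎
    where
    open ≡-Reasoning
    inside : k + p + i < N
    inside = inside-cube {k} {p} {i} k+p<3p fits
    regroup : ∀ k i N → k + i + N ≡ k + (N + i)
    regroup = solve-∀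

  no-cube : ∀ i p → 1 ≤ p → i + (p + p + p) ≤ N + N → ¬ Cube i p
  no-cube i p p≥1 fits with i ≤? n
  ... | yes i≤n = from-first-half i p p≥1 i≤n fits
  ... | no  i≰n with m≤n⇒∃[o]m+o≡n (≰⇒> i≰n)
  ...   | i′ , refl = λ cube → from-first-half i′ p p≥1 (≤-pred (cube-start p≥1 fits′)) (≤-trans fits′ (m≤m+n N N))
                                 (shift-back i′ p fits′ cube)
    where
    fits′ : i′ + (p + p + p) ≤ N
    fits′ = shifted-cube-fits {i′} {p} fits

theorem6 : (x : List Bool) → FactorOfTM x →
    (∃[ x″ ] x ≡ w1001 ++ x″) → (∃[ x′ ] x ≡ x′ ++ w1001) →
    Cubefree (x ++ false ∷ x ++ false ∷ [])
theorem6 x factor (x″ , x≡1001x″) (x′ , x≡x′1001) has-cube =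
  let i , p , p≥1 , fits , cube = cube-window (x0x0 x) has-cube
      centred = x0x0-centred x x′ x″ factor x≡1001x″ x≡x′1001
  in NoCube.no-cube centred i p p≥1 (subst (i + (p + p + p) ≤_) (length-x0x0 x x′ x≡x′1001) fits) cube
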